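{- Let $\rho$ be a positive integer, let $q'$ be a prime power, $q=(q')^{\rho+1}$, and let $v\geq\rho+1$. Then every $(\rho+1)$-fold strong blocking set in the subgeometry $PG(v,q')\subset PG(v,q)$ is a $\rho$-saturating set in $PG(v,q)$.
   Context: $PG(v,q)$ is the $v$-dimensional projective space over $F_q$; the subgeometry $PG(v,q')\subset PG(v,q)$ consists of the points admitting homogeneous coordinates with all entries in $F_{q'}$, with its subspaces being those spanned by such points. For $2\leq t\leq v$, a point set $B$ in $PG(v,q')$ is a $t$-fold strong blocking set if every $(t-1)$-dimensional subspace of $PG(v,q')$ is spanned by $t$ points of $B$. A point set $S\subseteq PG(v,q)$ is $\varrho$-saturating if for every point $x\in PG(v,q)$ there exist $\varrho+1$ points of $S$ generating a subspace of $PG(v,q)$ containing $x$, and $\varrho$ is the smallest value with this property. -}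

module Defs where

open import Level using (Level; _⊔_)
open import Data.Nat using (ℕ; zero; suc; _<_; _^_)
open import Data.Nat.Primality using (Prime)
open import Data.Fin using (Fin)
import Data.Fin as F
open import Data.Product using (Σ; ∃; _×_; _,_)
open import Relation.Nullary using (¬_)
open import Relation.Binary.PropositionalEquality using (_≡_)
open import Algebra.Bundles using (CommutativeRing)
open import Data.Unit.Polymorphic using (⊤)

IsPrimePower : ℕ → Set
IsPrimePower q = Σ ℕ λ p → Σ ℕ λ m → Prime p × (q ≡ p ^ suc m)

module _ {c ℓ : Level} (R : CommutativeRing c ℓ) where
  open CommutativeRing R

  IsField : Set (c ⊔ ℓ)
  IsField = (¬ (1# ≈ 0#)) × (∀ x → ¬ (x ≈ 0#) → ∃ λ y → x * y ≈ 1#)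

  HasSize : ℕ → Set (c ⊔ ℓ)
  HasSize n = Σ (Fin n → Carrier) λ e →
                (∀ i j → e i ≈ e j → i ≡ j) × (∀ x → ∃ λ i → x ≈ e i)

  IsSubfield : (Carrier → Set ℓ) → Set (c ⊔ ℓ)
  IsSubfield K =
      (∀ x y → x ≈ y → K x → K y)
    × K 0# × K 1#
    × (∀ x y → K x → K y → K (x + y))
    × (∀ x → K x → K (- x))
    × (∀ x y → K x → K y → K (x * y))
    × (∀ x y → K x → ¬ (x ≈ 0#) → x * y ≈ 1# → K y)

  SubHasSize : (Carrier → Set ℓ) → ℕ → Set (c ⊔ ℓ)
  SubHasSize K n = Σ (Fin n → Carrier) λ e →
                     (∀ i → K (e i))
                   × (∀ i j → e i ≈ e j → i ≡ j)
                   × (∀ x → K x → ∃ λ i → x ≈ e i)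

  -- Homogeneous coordinate vectors of PG(v, F): F^(v+1).
  Vect : ℕ → Set c
  Vect v = Fin (suc v) → Carrier

  Nonzero : ∀ {v} → Vect v → Set ℓ
  Nonzero x = ¬ (∀ i → x i ≈ 0#)

  Rational : (Carrier → Set ℓ) → ∀ {v} → Vect v → Set ℓ
  Rational K x = ∀ i → K (x i)

  sumF : ∀ k → (Fin k → Carrier) → Carrier
  sumF zero    f = 0#
  sumF (suc k) f = f F.zero + sumF k (λ j → f (F.suc j))

  InSpan : (Carrier → Set ℓ) → ∀ {v k} → (Fin k → Vect v) → Vect v → Set (c ⊔ ℓ)
  InSpan C {v} {k} u x = Σ (Fin k → Carrier) λ a →
                           (∀ j → C (a j))
                         × (∀ i → x i ≈ sumF k (λ j → a j * u j i))

  AnyC : Carrier → Set ℓ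
  AnyC _ = ⊤

  LinIndep : (Carrier → Set ℓ) → ∀ {v k} → (Fin k → Vect v) → Set (c ⊔ ℓ)
  LinIndep C {v} {k} u = ∀ (a : Fin k → Carrier) → (∀ j → C (a j))
                         → (∀ i → sumF k (λ j → a j * u j i) ≈ 0#)
                         → ∀ j → a j ≈ 0#

  SameSpan : (Carrier → Set ℓ) → ∀ {v k} → (Fin k → Vect v) → (Fin k → Vect v) → Set (c ⊔ ℓ)
  SameSpan C u w = (∀ j → InSpan C u (w j)) × (∀ j → InSpan C w (u j))

  -- A point set of PG(v, K) ⊂ PG(v, F), given by a predicate on homogeneous
  -- coordinate vectors (a point belongs to the set iff some representative
  -- satisfies the predicate); its representatives are nonzero and K-rational.
  IsPointSetOfSub : (K : Carrier → Set ℓ) → ∀ {v} → (Vect v → Set ℓ) → Set (c ⊔ ℓ)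
  IsPointSetOfSub K B = ∀ x → B x → Nonzero x × Rational K x

  -- B is a t-fold strong blocking set in PG(v, K): every (t-1)-dimensional
  -- subspace of PG(v, K) (the K-span of t K-independent K-rational vectors)
  -- is spanned (over K) by t points of B.
  StrongBlocking : (K : Carrier → Set ℓ) → ∀ {v} → ℕ → (Vect v → Set ℓ) → Set (c ⊔ ℓ)
  StrongBlocking K {v} t B =
    ∀ (u : Fin t → Vect v) → (∀ j → Rational K (u j)) → LinIndep K u →
    ∃ λ (b : Fin t → Vect v) → (∀ j → B (b j)) × SameSpan K u b

  Covers : ∀ {v} → ℕ → (Vect v → Set ℓ) → Set (c ⊔ ℓ)
  Covers {v} k S = ∀ (x : Vect v) → Nonzero x →
                   ∃ λ (s : Fin k → Vect v) → (∀ j → S (s j)) × InSpan AnyC s x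

  Saturating : ∀ {v} → ℕ → (Vect v → Set ℓ) → Set (c ⊔ ℓ)
  Saturating ϱ S = Covers (suc ϱ) S × (∀ ϱ′ → ϱ′ < ϱ → ¬ Covers (suc ϱ′) S)

-- Since q = q′^(ρ+1), F is a K-vector space of dimension ρ + 1; fix a K-basis E₀, …, E_ρ.
-- Expanding each coordinate of a point x of PG(v,q) in this basis writes x as an F-combination of
-- ρ + 1 K-rational vectors. These lie in a ρ-dimensional subspace of PG(v,q′), which the strong
-- blocking set spans with ρ + 1 of its points, so x lies in a subspace generated by ρ + 1 points of B.
-- Conversely the point (E₀, …, E_ρ, …) is in no subspace generated by ρ points of PG(v,q′):
-- comparing E-coordinates would put the ρ + 1 unit vectors of K^(ρ+1) into the K-span of ρ
-- vectors, contradicting the Steinitz bound.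
module Submission where

open import Level using (Level; _⊔_)
open import Data.Nat as ℕ using (ℕ; zero; suc; _≤_; _<_; _^_; z≤n; s≤s; z<s)
open import Data.Nat.Properties
  using (≤-trans; ≤-antisym; m≤n⇒m≤1+n; n≤1+n; <⇒≱; ≰⇒>; _≤?_; +-suc; m∸n+n≡m; m<n+m; <-≤-trans;
         <-cmp; <-irrefl; ^-monoʳ-<)
open import Data.Nat.Base using (nonTrivial⇒n>1)
open import Data.Nat.Primality using (prime⇒nonTrivial)
open import Data.Fin using (Fin; zero; suc; punchIn; inject≤; combine; funToFin; finToFun)
open import Data.Fin.Properties using (any?; all?; funToFin-finToFin; finToFun-funToFin; injective⇒≤)
  renaming (_≟_ to _≟ᶠ_)
open import Data.Product using (Σ; ∃; _×_; _,_; proj₁; proj₂)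
open import Data.Empty using (⊥-elim)
open import Data.Unit.Polymorphic using (tt)
open import Data.Vec.Functional using (_∷_; insertAt)
open import Data.Vec.Functional.Properties using (insertAt-lookup; insertAt-punchIn)
open import Relation.Nullary using (¬_; Dec; yes; no)
open import Relation.Nullary.Decidable using (¬?; decidable-stable; map′)
open import Relation.Binary using (Decidable; tri<; tri≈; tri>)
open import Relation.Binary.PropositionalEquality as ≡ using (_≡_)
open import Algebra.Bundles using (CommutativeRing)
open CommutativeRing using (Carrier)

open import Defs

insertAt-∀ : ∀ {a p} {A : Set a} (P : A → Set p) {n} (xs : Fin n → A) (i₀ : Fin (suc n)) {x : A} →
             P x → (∀ k → P (xs k)) → ∀ i → P (insertAt xs i₀ x i)
insertAt-∀ P          xs zero     px pxs zero    = px
insertAt-∀ P          xs zero     px pxs (suc i) = pxs i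
insertAt-∀ P {suc n}  xs (suc i₀) px pxs zero    = pxs zero
insertAt-∀ P {suc n}  xs (suc i₀) px pxs (suc i) =
  insertAt-∀ P (λ k → xs (suc k)) i₀ px (λ k → pxs (suc k)) i

^-cancelˡ-≡ : ∀ m {a b} → 1 < m → m ^ a ≡ m ^ b → a ≡ b
^-cancelˡ-≡ m {a} {b} 1<m eq with <-cmp a b
... | tri< a<b _ _ = ⊥-elim (<-irrefl eq (^-monoʳ-< m 1<m a<b))
... | tri≈ _ a≡b _ = a≡b
... | tri> _ _ b<a = ⊥-elim (<-irrefl (≡.sym eq) (^-monoʳ-< m 1<m b<a))

funToFin-cong : ∀ {m n} (f g : Fin m → Fin n) → (∀ j → f j ≡ g j) → funToFin f ≡ funToFin g
funToFin-cong {zero}  f g f≗g = ≡.refl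
funToFin-cong {suc m} f g f≗g =
  ≡.cong₂ combine (f≗g zero) (funToFin-cong (λ j → f (suc j)) (λ j → g (suc j)) (λ j → f≗g (suc j)))

-- A left inverse of inject≤ that sends the indices beyond the range to the last one.
clamp : ∀ {a b} → Fin (suc b) → Fin (suc a)
clamp {zero}          _       = zero
clamp {suc a}         zero    = zero
clamp {suc a} {suc b} (suc i) = suc (clamp i)

clamp-inject≤ : ∀ {a b} (k : Fin (suc a)) (a≤b : suc a ≤ suc b) → clamp (inject≤ k a≤b) ≡ k
clamp-inject≤ {zero}          zero    _         = ≡.refl
clamp-inject≤ {suc a} {zero}  _       (s≤s ())
clamp-inject≤ {suc a} {suc b} zero    _         = ≡.refl
clamp-inject≤ {suc a} {suc b} (suc k) (s≤s a≤b) = ≡.cong suc (clamp-inject≤ k a≤b)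

module FiniteSums {c ℓ : Level} (R : CommutativeRing c ℓ) where
  open CommutativeRing R renaming (Carrier to A) hiding (zero)
  open import Algebra.Properties.Semiring.Sum semiring
    using (sum; sum-remove; ∑-distrib-+; *-distribˡ-sum; *-distribʳ-sum)
    renaming (∑-comm to sum-comm)
  open import Algebra.Properties.Ring ring using (-1*x≈-x)
  open import Relation.Binary.Reasoning.Setoid setoid

  ∑ : ∀ k → (Fin k → A) → A
  ∑ = sumF R

  ∑≡sum : ∀ k (f : Fin k → A) → ∑ k f ≡ sum f
  ∑≡sum zero    f = ≡.refl
  ∑≡sum (suc k) f = ≡.cong (f zero +_) (∑≡sum k (λ j → f (suc j)))

  ∑-cong : ∀ k {f g : Fin k → A} → (∀ j → f j ≈ g j) → ∑ k f ≈ ∑ k g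
  ∑-cong zero    f≈g = refl
  ∑-cong (suc k) f≈g = +-cong (f≈g zero) (∑-cong k (λ j → f≈g (suc j)))

  ∑-zero : ∀ k {f : Fin k → A} → (∀ j → f j ≈ 0#) → ∑ k f ≈ 0#
  ∑-zero zero    f≈0 = refl
  ∑-zero (suc k) f≈0 = trans (+-cong (f≈0 zero) (∑-zero k (λ j → f≈0 (suc j)))) (+-identityʳ 0#)

  ∑-+ : ∀ k (f g : Fin k → A) → ∑ k (λ j → f j + g j) ≈ ∑ k f + ∑ k g
  ∑-+ k f g = begin
    ∑ k (λ j → f j + g j) ≡⟨ ∑≡sum k _ ⟩
    sum (λ j → f j + g j) ≈⟨ ∑-distrib-+ f g ⟩
    sum f + sum g         ≡⟨ ≡.cong₂ _+_ (∑≡sum k f) (∑≡sum k g) ⟨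
    ∑ k f + ∑ k g         ∎

  *-distribˡ-∑ : ∀ k x (f : Fin k → A) → x * ∑ k f ≈ ∑ k (λ j → x * f j)
  *-distribˡ-∑ k x f = begin
    x * ∑ k f             ≡⟨ ≡.cong (x *_) (∑≡sum k f) ⟩
    x * sum f             ≈⟨ *-distribˡ-sum x f ⟩
    sum (λ j → x * f j)   ≡⟨ ∑≡sum k _ ⟨
    ∑ k (λ j → x * f j)   ∎

  *-distribʳ-∑ : ∀ k x (f : Fin k → A) → ∑ k f * x ≈ ∑ k (λ j → f j * x)
  *-distribʳ-∑ k x f = begin
    ∑ k f * x             ≡⟨ ≡.cong (_* x) (∑≡sum k f) ⟩
    sum f * x             ≈⟨ *-distribʳ-sum x f ⟩
    sum (λ j → f j * x)   ≡⟨ ∑≡sum k _ ⟨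
    ∑ k (λ j → f j * x)   ∎

  -‿∑ : ∀ k (f : Fin k → A) → - ∑ k f ≈ ∑ k (λ j → - f j)
  -‿∑ k f = begin
    - ∑ k f                    ≈⟨ -1*x≈-x _ ⟨
    - 1# * ∑ k f               ≈⟨ *-distribˡ-∑ k (- 1#) f ⟩
    ∑ k (λ j → - 1# * f j)     ≈⟨ ∑-cong k (λ j → -1*x≈-x (f j)) ⟩
    ∑ k (λ j → - f j)          ∎

  ∑-− : ∀ k (f g : Fin k → A) → ∑ k (λ j → f j - g j) ≈ ∑ k f - ∑ k g
  ∑-− k f g = trans (∑-+ k f (λ j → - g j)) (+-congˡ (sym (-‿∑ k g)))

  ∑-comm : ∀ m n (f : Fin m → Fin n → A) →
           ∑ m (λ i → ∑ n (λ j → f i j)) ≈ ∑ n (λ j → ∑ m (λ i → f i j))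
  ∑-comm m n f = begin
    ∑ m (λ i → ∑ n (f i))               ≈⟨ ∑-cong m (λ i → reflexive (∑≡sum n (f i))) ⟩
    ∑ m (λ i → sum (f i))               ≡⟨ ∑≡sum m _ ⟩
    sum (λ i → sum (f i))               ≈⟨ sum-comm f ⟩
    sum (λ j → sum (λ i → f i j))       ≡⟨ ∑≡sum n _ ⟨
    ∑ n (λ j → sum (λ i → f i j))       ≈⟨ ∑-cong n (λ j → reflexive (∑≡sum m _)) ⟨
    ∑ n (λ j → ∑ m (λ i → f i j))       ∎

  ∑-remove : ∀ k (i : Fin (suc k)) (f : Fin (suc k) → A) →
             ∑ (suc k) f ≈ f i + ∑ k (λ j → f (punchIn i j))
  ∑-remove k i f = begin
    ∑ (suc k) f                          ≡⟨ ∑≡sum (suc k) f ⟩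
    sum f                                ≈⟨ sum-remove {i = i} f ⟩
    f i + sum (λ j → f (punchIn i j))    ≡⟨ ≡.cong (f i +_) (∑≡sum k _) ⟨
    f i + ∑ k (λ j → f (punchIn i j))    ∎

  δ : ∀ {k} → Fin k → Fin k → A
  δ zero    zero    = 1#
  δ zero    (suc _) = 0#
  δ (suc _) zero    = 0#
  δ (suc j) (suc i) = δ j i

  δ-refl : ∀ {k} (i : Fin k) → δ i i ≡ 1#
  δ-refl zero    = ≡.refl
  δ-refl (suc i) = δ-refl i

  ∑-δ : ∀ k (f : Fin k → A) (i : Fin k) → ∑ k (λ j → δ j i * f j) ≈ f i
  ∑-δ (suc k) f zero = begin
    1# * f zero + ∑ k (λ j → 0# * f (suc j))   ≈⟨ +-cong (*-identityˡ _) (∑-zero k (λ j → zeroˡ _)) ⟩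
    f zero + 0#                                 ≈⟨ +-identityʳ _ ⟩
    f zero                                      ∎
  ∑-δ (suc k) f (suc i) = begin
    0# * f zero + ∑ k (λ j → δ j i * f (suc j)) ≈⟨ +-cong (zeroˡ _) (∑-δ k (λ j → f (suc j)) i) ⟩
    0# + f (suc i)                              ≈⟨ +-identityˡ _ ⟩
    f (suc i)                                   ∎

module LinearCombinations {c ℓ : Level} (R : CommutativeRing c ℓ) where
  open CommutativeRing R renaming (Carrier to A) hiding (zero)
  open FiniteSums R
  open import Relation.Binary.Reasoning.Setoid setoid

  ∑-lincomb : ∀ {n p r} (a : Fin p → A) (u : Fin p → Vect R n) (x : Vect R n)
                (cf : Fin p → Fin r → A) (b : Fin r → Vect R n) →
              (∀ i → x i ≈ ∑ p (λ j → a j * u j i)) → (∀ j i → u j i ≈ ∑ r (λ k → cf j k * b k i)) →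
              ∀ i → x i ≈ ∑ r (λ k → ∑ p (λ j → a j * cf j k) * b k i)
  ∑-lincomb {p = p} {r} a u x cf b x≈au u≈cfb i = begin
    x i                                             ≈⟨ x≈au i ⟩
    ∑ p (λ j → a j * u j i)                         ≈⟨ ∑-cong p (λ j → *-congˡ (u≈cfb j i)) ⟩
    ∑ p (λ j → a j * ∑ r (λ k → cf j k * b k i))    ≈⟨ ∑-cong p (λ j → *-distribˡ-∑ r (a j) _) ⟩
    ∑ p (λ j → ∑ r (λ k → a j * (cf j k * b k i)))  ≈⟨ ∑-comm p r _ ⟩
    ∑ r (λ k → ∑ p (λ j → a j * (cf j k * b k i)))  ≈⟨ ∑-cong r (λ k → ∑-cong p (λ j → *-assoc _ _ _)) ⟨
    ∑ r (λ k → ∑ p (λ j → a j * cf j k * b k i))    ≈⟨ ∑-cong r (λ k → *-distribʳ-∑ p _ _) ⟨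
    ∑ r (λ k → ∑ p (λ j → a j * cf j k) * b k i)    ∎

  InSpan-trans : ∀ {n p r} {C : A → Set ℓ} →
                 (∀ k (f : Fin k → A) → (∀ j → C (f j)) → C (∑ k f)) → (∀ x y → C x → C y → C (x * y)) →
                 {u : Fin p → Vect R n} {x : Vect R n} {b : Fin r → Vect R n} →
                 InSpan R C u x → (∀ j → InSpan R C b (u j)) → InSpan R C b x
  InSpan-trans {p = p} {r} C-∑ C-* {u} {x} {b} (a , Ca , x≈au) u⊆b =
    (λ k → ∑ p (λ j → a j * cf j k)) ,
    (λ k → C-∑ p _ (λ j → C-* _ _ (Ca j) (proj₁ (proj₂ (u⊆b j)) k))) ,
    ∑-lincomb a u x cf b x≈au (λ j → proj₂ (proj₂ (u⊆b j)))
    where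
      cf : Fin p → Fin r → A
      cf j = proj₁ (u⊆b j)

  InSpanAnyC-trans : ∀ {n p r} {u : Fin p → Vect R n} {x : Vect R n} {b : Fin r → Vect R n} →
                     InSpan R (AnyC R) u x → (∀ j → InSpan R (AnyC R) b (u j)) → InSpan R (AnyC R) b x
  InSpanAnyC-trans = InSpan-trans (λ _ _ _ → tt) (λ _ _ _ _ → tt)

  InSpan⇒InSpan-AnyC : ∀ {n r} {C : A → Set ℓ} {u : Fin r → Vect R n} {x : Vect R n} →
                       InSpan R C u x → InSpan R (AnyC R) u x
  InSpan⇒InSpan-AnyC (a , _ , x≈au) = a , _ , x≈au

module _ {c ℓ : Level} (R : CommutativeRing c ℓ) where
  open CommutativeRing R renaming (Carrier to A)

  HasSize⇒decidable : ∀ {n} → HasSize R n → Decidable _≈_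
  HasSize⇒decidable {n} (e , e-injective , e-surjective) x y =
    map′ (λ eq → trans (≈index x) (trans (reflexive (≡.cong e eq)) (sym (≈index y))))
         (λ x≈y → e-injective _ _ (trans (sym (≈index x)) (trans x≈y (≈index y))))
         (index x ≟ᶠ index y)
    where
      index : A → Fin n
      index z = proj₁ (e-surjective z)

      ≈index : ∀ z → z ≈ e (index z)
      ≈index z = proj₂ (e-surjective z)

module SubfieldLinearAlgebra {c ℓ : Level} (F : CommutativeRing c ℓ) (isField : IsField F)
  (_≟_ : Decidable (CommutativeRing._≈_ F))
  (K : Carrier F → Set ℓ) (isSubfield : IsSubfield F K) where

  open CommutativeRing F renaming (Carrier to A) hiding (zero)
  open import Algebra.Properties.Ring ring using (-‿distribˡ-*; -‿distribʳ-*; x[y-z]≈xy-xz; [y-z]x≈yx-zx;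
    x∙y⁻¹≈ε⇒x≈y; +-inverseˡ-unique)
  open import Relation.Binary.Reasoning.Setoid setoid
  open FiniteSums F
  open LinearCombinations F

  1≉0 : ¬ (1# ≈ 0#)
  1≉0 = proj₁ isField

  inverse : ∀ x → ¬ (x ≈ 0#) → ∃ λ y → x * y ≈ 1#
  inverse = proj₂ isField

  K-0 : K 0#
  K-0 = proj₁ (proj₂ isSubfield)

  K-1 : K 1#
  K-1 = proj₁ (proj₂ (proj₂ isSubfield))

  K-+ : ∀ x y → K x → K y → K (x + y)
  K-+ = proj₁ (proj₂ (proj₂ (proj₂ isSubfield)))

  K-neg : ∀ x → K x → K (- x)
  K-neg = proj₁ (proj₂ (proj₂ (proj₂ (proj₂ isSubfield))))

  K-* : ∀ x y → K x → K y → K (x * y)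
  K-* = proj₁ (proj₂ (proj₂ (proj₂ (proj₂ (proj₂ isSubfield)))))

  K-inverse : ∀ x y → K x → ¬ (x ≈ 0#) → x * y ≈ 1# → K y
  K-inverse = proj₂ (proj₂ (proj₂ (proj₂ (proj₂ (proj₂ isSubfield)))))

  K-− : ∀ x y → K x → K y → K (x - y)
  K-− x y Kx Ky = K-+ _ _ Kx (K-neg _ Ky)

  K-∑ : ∀ k (f : Fin k → A) → (∀ j → K (f j)) → K (∑ k f)
  K-∑ zero    f Kf = K-0
  K-∑ (suc k) f Kf = K-+ _ _ (Kf zero) (K-∑ k (λ j → f (suc j)) (λ j → Kf (suc j)))

  K-δ : ∀ {k} (i j : Fin k) → K (δ i j)
  K-δ zero    zero    = K-1
  K-δ zero    (suc j) = K-0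
  K-δ (suc i) zero    = K-0
  K-δ (suc i) (suc j) = K-δ i j

  InSpanK-trans : ∀ {n p r} {u : Fin p → Vect F n} {x : Vect F n} {b : Fin r → Vect F n} →
                  InSpan F K u x → (∀ j → InSpan F K b (u j)) → InSpan F K b x
  InSpanK-trans = InSpan-trans K-∑ K-*

  LinIndep⇒coefficients-unique : ∀ {n k} {u : Fin k → Vect F n} → LinIndep F K u →
    (a b : Fin k → A) → (∀ j → K (a j)) → (∀ j → K (b j)) →
    (∀ i → ∑ k (λ j → a j * u j i) ≈ ∑ k (λ j → b j * u j i)) → ∀ j → a j ≈ b j
  LinIndep⇒coefficients-unique {k = k} {u} indep a b Ka Kb au≈bu j =
    x∙y⁻¹≈ε⇒x≈y _ _ (indep (λ j → a j - b j) (λ j → K-− _ _ (Ka j) (Kb j)) difference≈0 j)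
    where
      difference≈0 : ∀ i → ∑ k (λ j → (a j - b j) * u j i) ≈ 0#
      difference≈0 i = begin
        ∑ k (λ j → (a j - b j) * u j i)                  ≈⟨ ∑-cong k (λ j → [y-z]x≈yx-zx _ _ _) ⟩
        ∑ k (λ j → a j * u j i - b j * u j i)            ≈⟨ ∑-− k _ _ ⟩
        ∑ k (λ j → a j * u j i) - ∑ k (λ j → b j * u j i) ≈⟨ +-congʳ (au≈bu i) ⟩
        ∑ k (λ j → b j * u j i) - ∑ k (λ j → b j * u j i) ≈⟨ -‿inverseʳ _ ⟩
        0#                                               ∎

  -- cf i j is the coefficient of the i-th unknown in the j-th equation.
  Solves : ∀ {m p} → (Fin m → A) → (Fin m → Fin p → A) → Set ℓ
  Solves {m} a cf = ∀ j → ∑ m (λ i → a i * cf i j) ≈ 0#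

  NontrivialSolution : ∀ {m p} → (Fin m → Fin p → A) → Set (c ⊔ ℓ)
  NontrivialSolution cf = ∃ λ a → (∀ i → K (a i)) × (∃ λ i → ¬ (a i ≈ 0#)) × Solves a cf

  NontrivialSolution-dropEquation : ∀ {m p} (cf : Fin m → Fin (suc p) → A) → (∀ i → cf i zero ≈ 0#) →
    NontrivialSolution (λ i j → cf i (suc j)) → NontrivialSolution cf
  NontrivialSolution-dropEquation {m} cf cf≈0 (a , Ka , a≉0 , solves) = a , Ka , a≉0 , solves′
    where
      solves′ : Solves a cf
      solves′ zero    = ∑-zero m (λ i → trans (*-congˡ (cf≈0 i)) (zeroʳ _))
      solves′ (suc j) = solves j

  -- Gaussian elimination of the i₀-th unknown using the first equation, t being the inverse of its
  -- coefficient there.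
  module Elimination {m p} (cf : Fin (suc m) → Fin (suc p) → A) (i₀ : Fin (suc m)) (t : A) where

    factor : Fin m → A
    factor k = cf (punchIn i₀ k) zero * t

    reduced : Fin m → Fin (suc p) → A
    reduced k j = cf (punchIn i₀ k) j - factor k * cf i₀ j

    backValue : (Fin m → A) → A
    backValue b = - ∑ m (λ k → b k * factor k)

    back-substitution : ∀ b j → ∑ (suc m) (λ i → insertAt b i₀ (backValue b) i * cf i j)
                                ≈ ∑ m (λ k → b k * reduced k j)
    back-substitution b j = begin
      ∑ (suc m) (λ i → a i * cf i j)
        ≈⟨ ∑-remove m i₀ (λ i → a i * cf i j) ⟩
      a i₀ * cf i₀ j + ∑ m (λ k → a (punchIn i₀ k) * cf (punchIn i₀ k) j)
        ≈⟨ +-cong (*-congʳ (reflexive (insertAt-lookup b i₀ α)))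
                  (∑-cong m (λ k → *-congʳ (reflexive (insertAt-punchIn b i₀ α k)))) ⟩
      α * cf i₀ j + ∑ m (λ k → b k * cf (punchIn i₀ k) j)
        ≈⟨ +-comm _ _ ⟩
      ∑ m (λ k → b k * cf (punchIn i₀ k) j) + α * cf i₀ j
        ≈⟨ +-congˡ (-‿distribˡ-* _ _) ⟨
      ∑ m (λ k → b k * cf (punchIn i₀ k) j) - ∑ m (λ k → b k * factor k) * cf i₀ j
        ≈⟨ +-congˡ (-‿cong (*-distribʳ-∑ m _ _)) ⟩
      ∑ m (λ k → b k * cf (punchIn i₀ k) j) - ∑ m (λ k → b k * factor k * cf i₀ j)
        ≈⟨ +-congˡ (-‿cong (∑-cong m (λ k → *-assoc _ _ _))) ⟩
      ∑ m (λ k → b k * cf (punchIn i₀ k) j) - ∑ m (λ k → b k * (factor k * cf i₀ j))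
        ≈⟨ ∑-− m _ _ ⟨
      ∑ m (λ k → b k * cf (punchIn i₀ k) j - b k * (factor k * cf i₀ j))
        ≈⟨ ∑-cong m (λ k → x[y-z]≈xy-xz _ _ _) ⟨
      ∑ m (λ k → b k * reduced k j)
        ∎
      where
        α : A
        α = backValue b

        a : Fin (suc m) → A
        a = insertAt b i₀ α

    reduced-pivot : cf i₀ zero * t ≈ 1# → ∀ k → reduced k zero ≈ 0#
    reduced-pivot ct≈1 k = begin
      x - x * t * cf i₀ zero   ≈⟨ +-congˡ (-‿cong (*-assoc _ _ _)) ⟩
      x - x * (t * cf i₀ zero) ≈⟨ +-congˡ (-‿cong (*-congˡ (trans (*-comm _ _) ct≈1))) ⟩
      x - x * 1#               ≈⟨ +-congˡ (-‿cong (*-identityʳ x)) ⟩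
      x - x                    ≈⟨ -‿inverseʳ x ⟩
      0#                       ∎
      where x = cf (punchIn i₀ k) zero

    module _ (Kcf : ∀ i j → K (cf i j)) (Kt : K t) where

      K-factor : ∀ k → K (factor k)
      K-factor k = K-* _ _ (Kcf _ _) Kt

      K-reduced : ∀ k j → K (reduced k j)
      K-reduced k j = K-− _ _ (Kcf _ _) (K-* _ _ (K-factor k) (Kcf _ _))

      NontrivialSolution-backSubstitute : cf i₀ zero * t ≈ 1# →
        NontrivialSolution (λ k j → reduced k (suc j)) → NontrivialSolution cf
      NontrivialSolution-backSubstitute ct≈1 (b , Kb , (k₀ , bk₀≉0) , solves) =
        insertAt b i₀ (backValue b) ,
        insertAt-∀ K b i₀ (K-neg _ (K-∑ m _ (λ k → K-* _ _ (Kb k) (K-factor k)))) Kb ,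
        (punchIn i₀ k₀ , λ ak₀≈0 → bk₀≉0 (trans (reflexive (≡.sym (insertAt-punchIn b i₀ _ k₀))) ak₀≈0)) ,
        solves′
        where
          solves′ : Solves (insertAt b i₀ (backValue b)) cf
          solves′ zero    = trans (back-substitution b zero)
                                  (∑-zero m (λ k → trans (*-congˡ (reduced-pivot ct≈1 k)) (zeroʳ _)))
          solves′ (suc j) = trans (back-substitution b (suc j)) (solves j)

  nontrivial-solution : ∀ p m → p < m → (cf : Fin m → Fin p → A) → (∀ i j → K (cf i j)) →
                        NontrivialSolution cf
  nontrivial-solution zero    (suc m) _ cf _ = δ zero , K-δ zero , (zero , 1≉0) , λ ()
  nontrivial-solution (suc p) (suc m) (s≤s p<m) cf Kcf with any? (λ i → ¬? (cf i zero ≟ 0#))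
  ... | no no-pivot =
    NontrivialSolution-dropEquation cf (λ i → decidable-stable (cf i zero ≟ 0#) (λ ne → no-pivot (i , ne)))
      (nontrivial-solution p (suc m) (m≤n⇒m≤1+n p<m) (λ i j → cf i (suc j)) (λ i j → Kcf i (suc j)))
  ... | yes (i₀ , pivot≉0) with inverse (cf i₀ zero) pivot≉0
  ...   | t , ct≈1 =
    NontrivialSolution-backSubstitute Kcf Kt ct≈1
      (nontrivial-solution p m p<m (λ k j → reduced k (suc j)) (λ k j → K-reduced Kcf Kt k (suc j)))
    where
      open Elimination cf i₀ t

      Kt : K t
      Kt = K-inverse _ _ (Kcf i₀ zero) pivot≉0 ct≈1

  -- Steinitz: more than p vectors in the span of p vectors are dependent, because a relation
  -- among their coefficient rows is a relation among the vectors themselves.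
  LinIndep⇒≤ : ∀ {n m p} (w : Fin m → Vect F n) (s : Fin p → Vect F n) →
               LinIndep F K w → (∀ i → InSpan F K s (w i)) → m ≤ p
  LinIndep⇒≤ {m = m} {p} w s indep w⊆s with m ≤? p
  ... | yes m≤p = m≤p
  ... | no m≰p =
    let (a , Ka , (i , ai≉0) , solves) = nontrivial-solution p m (≰⇒> m≰p) cf (λ i → proj₁ (proj₂ (w⊆s i)))
    in ⊥-elim (ai≉0 (indep a Ka (relation a solves) i))
    where
      cf : Fin m → Fin p → A
      cf i = proj₁ (w⊆s i)

      relation : ∀ a → Solves a cf → ∀ l → ∑ m (λ i → a i * w i l) ≈ 0#
      relation a solves l =
        trans (∑-lincomb a w (λ l → ∑ m (λ i → a i * w i l)) cf s (λ _ → refl) (λ i → proj₂ (proj₂ (w⊆s i))) l)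
              (∑-zero p (λ k → trans (*-congʳ (solves k)) (zeroˡ _)))

  InSpan-self : ∀ {n r} (u : Fin r → Vect F n) (j : Fin r) → InSpan F K u (u j)
  InSpan-self {r = r} u j = (λ k → δ k j) , (λ k → K-δ k j) , (λ i → sym (∑-δ r (λ k → u k i) j))

  InSpan-∷ : ∀ {n r} {u : Fin r → Vect F n} {x : Vect F n} (y : Vect F n) →
             InSpan F K u x → InSpan F K (y ∷ u) x
  InSpan-∷ y (a , Ka , x≈au) =
    (0# ∷ a) , (λ { zero → K-0 ; (suc j) → Ka j }) ,
    (λ i → trans (x≈au i) (sym (trans (+-congʳ (zeroˡ _)) (+-identityˡ _))))

  LinIndep-∷ : ∀ {n r} {u : Fin r → Vect F n} (y : Vect F n) →
               LinIndep F K u → ¬ InSpan F K u y → LinIndep F K (y ∷ u)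
  LinIndep-∷ {r = r} {u} y indep y∉u a Ka a[y∷u]≈0 = coefficients≈0
    where
      tail-sum : Fin _ → A
      tail-sum i = ∑ r (λ j → a (suc j) * u j i)

      -- If a zero ≉ 0, dividing the relation by it expresses y through u.
      y∈u : ¬ (a zero ≈ 0#) → InSpan F K u y
      y∈u a₀≉0 with inverse (a zero) a₀≉0
      ... | t , a₀t≈1 =
        (λ j → - (t * a (suc j))) ,
        (λ j → K-neg _ (K-* _ _ (K-inverse _ _ (Ka zero) a₀≉0 a₀t≈1) (Ka (suc j)))) ,
        λ i → begin
          y i                                        ≈⟨ *-identityˡ _ ⟨
          1# * y i                                   ≈⟨ *-congʳ (trans (*-comm _ _) a₀t≈1) ⟨
          t * a zero * y i                           ≈⟨ *-assoc _ _ _ ⟩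
          t * (a zero * y i)                         ≈⟨ *-congˡ (+-inverseˡ-unique _ _ (a[y∷u]≈0 i)) ⟩
          t * (- tail-sum i)                         ≈⟨ -‿distribʳ-* _ _ ⟨
          - (t * tail-sum i)                         ≈⟨ -‿cong (*-distribˡ-∑ r t _) ⟩
          - ∑ r (λ j → t * (a (suc j) * u j i))      ≈⟨ -‿∑ r _ ⟩
          ∑ r (λ j → - (t * (a (suc j) * u j i)))    ≈⟨ ∑-cong r (λ j → -‿cong (*-assoc _ _ _)) ⟨
          ∑ r (λ j → - (t * a (suc j) * u j i))      ≈⟨ ∑-cong r (λ j → -‿distribˡ-* _ _) ⟩
          ∑ r (λ j → - (t * a (suc j)) * u j i)      ∎

      a₀≈0 : a zero ≈ 0#
      a₀≈0 = decidable-stable (a zero ≟ 0#) (λ a₀≉0 → y∉u (y∈u a₀≉0))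

      coefficients≈0 : ∀ j → a j ≈ 0#
      coefficients≈0 zero    = a₀≈0
      coefficients≈0 (suc j) =
        indep (λ j → a (suc j)) (λ j → Ka (suc j))
          (λ i → trans (sym (trans (+-congʳ (trans (*-congʳ a₀≈0) (zeroˡ _))) (+-identityˡ _))) (a[y∷u]≈0 i))
          j

  unitVector : ∀ {n} → Fin (suc n) → Vect F n
  unitVector = δ

  LinIndep-unitVector : ∀ {n} → LinIndep F K (unitVector {n})
  LinIndep-unitVector {n} a _ a·unit≈0 i =
    trans (sym (∑-δ (suc n) a i)) (trans (∑-cong (suc n) (λ j → *-comm (unitVector j i) (a j))) (a·unit≈0 i))

  LinIndep⇒nonzero : ∀ {n r} {u : Fin r → Vect F n} → LinIndep F K u → ∀ j → Nonzero F (u j)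
  LinIndep⇒nonzero {r = r} {u} indep j uj≈0 =
    1≉0 (trans (reflexive (≡.sym (δ-refl j)))
               (indep (λ k → δ k j) (λ k → K-δ k j) (λ i → trans (∑-δ r (λ k → u k i) j) (uj≈0 i)) j))

  -- Elements of F are identified with vectors of length one, so a K-basis of F is a family
  -- Fin d → Vect F 0.
  IsBasis : ∀ {d} → (Fin d → Vect F 0) → Set (c ⊔ ℓ)
  IsBasis E = LinIndep F K E × (∀ x → InSpan F K E (λ _ → x))

  module FiniteSubfield (q′ : ℕ) (K-size : SubHasSize F K q′) where

    elementK : Fin q′ → A
    elementK = proj₁ K-size

    K-elementK : ∀ i → K (elementK i)
    K-elementK = proj₁ (proj₂ K-size)

    elementK-injective : ∀ i j → elementK i ≈ elementK j → i ≡ j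
    elementK-injective = proj₁ (proj₂ (proj₂ K-size))

    indexK : ∀ x → K x → Fin q′
    indexK x Kx = proj₁ (proj₂ (proj₂ (proj₂ K-size)) x Kx)

    ≈elementK-indexK : ∀ x Kx → x ≈ elementK (indexK x Kx)
    ≈elementK-indexK x Kx = proj₂ (proj₂ (proj₂ (proj₂ K-size)) x Kx)

    code : ∀ {r} (a : Fin r → A) → (∀ j → K (a j)) → Fin r → Fin q′
    code a Ka j = indexK (a j) (Ka j)

    decode : ∀ {r} → (Fin r → Fin q′) → Fin r → A
    decode κ j = elementK (κ j)

    ≈decode-code : ∀ {r} (a : Fin r → A) Ka j → a j ≈ decode (code {r} a Ka) j
    ≈decode-code a Ka j = ≈elementK-indexK (a j) (Ka j)

    combination : ∀ {n r} → (Fin r → Vect F n) → (Fin r → Fin q′) → Vect F n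
    combination {r = r} u κ i = ∑ r (λ j → decode κ j * u j i)

    -- The K-coefficient vectors of length r are enumerated by Fin (q′ ^ r), which makes spans searchable.
    InSpan? : ∀ {n r} (u : Fin r → Vect F n) (y : Vect F n) → Dec (InSpan F K u y)
    InSpan? {r = r} u y with any? (λ κ → all? (λ i → y i ≟ combination u (finToFun κ) i))
    ... | yes (κ , y≈uκ) = yes (decode (finToFun κ) , (λ j → K-elementK _) , y≈uκ)
    ... | no no-code = no λ (a , Ka , y≈au) →
      no-code (funToFin (code a Ka) , λ i → trans (y≈au i) (∑-cong r (λ j → *-congʳ
        (trans (≈decode-code a Ka j) (reflexive (≡.cong elementK (≡.sym (finToFun-funToFin _ j))))))))

    independent-subfamily : ∀ {n} N (w : Fin N → Vect F n) →
      ∃ λ r → Σ (Fin r → Vect F n) λ u → r ≤ N × LinIndep F K u × (∀ t → InSpan F K u (w t))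
                                         × (∀ j → ∃ λ t → u j ≡ w t)
    independent-subfamily zero w = 0 , (λ ()) , z≤n , (λ _ _ _ ()) , (λ ()) , (λ ())
    independent-subfamily (suc N) w with independent-subfamily N (λ t → w (suc t))
    ... | r , u , r≤N , indep , w⊆u , u⊆w with InSpan? u (w zero)
    ...   | yes w₀∈u = r , u , m≤n⇒m≤1+n r≤N , indep , (λ { zero → w₀∈u ; (suc t) → w⊆u t }) ,
                       (λ j → suc (proj₁ (u⊆w j)) , proj₂ (u⊆w j))
    ...   | no w₀∉u = suc r , w zero ∷ u , s≤s r≤N , LinIndep-∷ (w zero) indep w₀∉u ,
                      (λ { zero → InSpan-self (w zero ∷ u) zero ; (suc t) → InSpan-∷ (w zero) (w⊆u t) }) ,
                      (λ { zero → zero , ≡.refl ; (suc j) → suc (proj₁ (u⊆w j)) , proj₂ (u⊆w j) })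

    -- Completion by unit vectors: while fewer than n + 1 independent vectors are present, some unit
    -- vector lies outside their span.
    extend-independent : ∀ {n} f r k → f ℕ.+ r ≡ k → k ≤ suc n → (u : Fin r → Vect F n) →
      LinIndep F K u → (∀ j → Rational F K (u j)) →
      Σ (Fin k → Vect F n) λ u′ → LinIndep F K u′ × (∀ j → Rational F K (u′ j)) × (∀ j → InSpan F K u′ (u j))
    extend-independent zero r .r ≡.refl _ u indep u-rational = u , indep , u-rational , InSpan-self u
    extend-independent {n} (suc f) r k f+r≡k k≤n u indep u-rational
      with any? (λ i → ¬? (InSpan? u (unitVector {n} i)))
    ... | yes (i , unit∉u) =
      let (u′ , indep′ , u′-rational , unit∷u⊆u′) =
            extend-independent f (suc r) k (≡.trans (+-suc f r) f+r≡k) k≤n (unitVector i ∷ u)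
              (LinIndep-∷ _ indep unit∉u) (λ { zero l → K-δ i l ; (suc j) → u-rational j })
      in u′ , indep′ , u′-rational ,
         λ j → InSpanK-trans {u = unitVector i ∷ u} {b = u′} (InSpan-∷ (unitVector i) (InSpan-self u j)) unit∷u⊆u′
    ... | no all-units∈u = ⊥-elim (<⇒≱ r<n+1 (LinIndep⇒≤ unitVector u LinIndep-unitVector units∈u))
      where
        units∈u : ∀ i → InSpan F K u (unitVector i)
        units∈u i = decidable-stable (InSpan? u (unitVector i)) (λ unit∉u → all-units∈u (i , unit∉u))

        r<n+1 : r < suc n
        r<n+1 = <-≤-trans (≡.subst (r <_) f+r≡k (m<n+m r z<s)) k≤n

    independent-hull : ∀ {n k} → k ≤ suc n → (w : Fin k → Vect F n) → (∀ j → Rational F K (w j)) →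
      Σ (Fin k → Vect F n) λ u → LinIndep F K u × (∀ j → Rational F K (u j)) × (∀ j → InSpan F K u (w j))
    independent-hull {k = k} k≤n w w-rational =
      let (r , u , r≤k , indep , w⊆u , u⊆w) = independent-subfamily k w
          u-rational j = ≡.subst (Rational F K) (≡.sym (proj₂ (u⊆w j))) (w-rational (proj₁ (u⊆w j)))
          (u′ , indep′ , u′-rational , u⊆u′) = extend-independent (k ℕ.∸ r) r k (m∸n+n≡m r≤k) k≤n u indep u-rational
      in u′ , indep′ , u′-rational , λ j → InSpanK-trans {u = u} {b = u′} (w⊆u j) u⊆u′

    module _ (q : ℕ) (F-size : HasSize F q) where

      private
        element : Fin q → A
        element = proj₁ F-size

        index : A → Fin q
        index x = proj₁ (proj₂ (proj₂ F-size) x)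

        ≈element-index : ∀ x → x ≈ element (index x)
        ≈element-index x = proj₂ (proj₂ (proj₂ F-size) x)

        element-injective : ∀ t t′ → element t ≈ element t′ → t ≡ t′
        element-injective = proj₁ (proj₂ F-size)

      basis-size : ∀ {d} (E : Fin d → Vect F 0) → IsBasis E → q ≡ q′ ^ d
      basis-size {d} E (indep , spans) =
        ≤-antisym (injective⇒≤ coordinates-injective) (injective⇒≤ value-injective)
        where
          value : Fin (q′ ^ d) → Fin q
          value κ = index (combination E (finToFun κ) zero)

          value-injective : ∀ {κ κ′} → value κ ≡ value κ′ → κ ≡ κ′
          value-injective {κ} {κ′} eq =
            ≡.trans (≡.sym (funToFin-finToFin {d} {q′} κ))
              (≡.trans (funToFin-cong _ _ same-digits) (funToFin-finToFin {d} {q′} κ′))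
            where
              same-combination : combination E (finToFun κ) zero ≈ combination E (finToFun κ′) zero
              same-combination = trans (≈element-index _) (trans (reflexive (≡.cong element eq))
                                                                 (sym (≈element-index _)))
              same-digits : ∀ j → finToFun κ j ≡ finToFun κ′ j
              same-digits j = elementK-injective _ _
                (LinIndep⇒coefficients-unique indep _ _ (λ _ → K-elementK _) (λ _ → K-elementK _)
                   (λ { zero → same-combination }) j)

          digits : A → Fin d → Fin q′
          digits x = code (proj₁ (spans x)) (proj₁ (proj₂ (spans x)))

          ≈combination-digits : ∀ x → x ≈ combination E (digits x) zero
          ≈combination-digits x = trans (proj₂ (proj₂ (spans x)) zero)
            (∑-cong d (λ j → *-congʳ (≈decode-code (proj₁ (spans x)) (proj₁ (proj₂ (spans x))) j)))

          coordinates : Fin q → Fin (q′ ^ d)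
          coordinates t = funToFin (digits (element t))

          coordinates-injective : ∀ {t t′} → coordinates t ≡ coordinates t′ → t ≡ t′
          coordinates-injective {t} {t′} eq = element-injective t t′
            (trans (≈combination-digits (element t))
              (trans (∑-cong d (λ j → *-congʳ (reflexive (≡.cong elementK (same-digits j)))))
                     (sym (≈combination-digits (element t′)))))
            where
              same-digits : ∀ j → digits (element t) j ≡ digits (element t′) j
              same-digits j = ≡.trans (≡.sym (finToFun-funToFin _ j))
                                (≡.trans (≡.cong (λ κ → finToFun κ j) eq) (finToFun-funToFin _ j))

      basis-of-size : ∀ {n} → q ≡ q′ ^ n → 1 < q′ → Σ (Fin n → Vect F 0) IsBasis
      basis-of-size {n} q≡q′^n 1<q′ with independent-subfamily q (λ t _ → element t)
      ... | d , E , _ , indep , elements∈E , _ =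
        ≡.subst (λ d → Σ (Fin d → Vect F 0) IsBasis)
                (^-cancelˡ-≡ q′ 1<q′ (≡.trans (≡.sym (basis-size E (indep , spans))) q≡q′^n))
                (E , indep , spans)
        where
          spans : ∀ x → InSpan F K E (λ _ → x)
          spans x with elements∈E (index x)
          ... | a , Ka , element≈aE = a , Ka , λ i → trans (≈element-index x) (element≈aE i)

    module Subgeometry {ρ} (E : Fin (suc ρ) → Vect F 0) (E-basis : IsBasis E) where

      private
        E-indep : LinIndep F K E
        E-indep = proj₁ E-basis

        E-spans : ∀ x → InSpan F K E (λ _ → x)
        E-spans = proj₂ E-basis

      rational-decomposition : ∀ {v} (x : Vect F v) →
        Σ (Fin (suc ρ) → Vect F v) λ w → (∀ k → Rational F K (w k)) × InSpan F (AnyC F) w x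
      rational-decomposition x =
        w , (λ k i → proj₁ (proj₂ (E-spans (x i))) k) ,
        (λ k → E k zero) , _ ,
        λ i → trans (proj₂ (proj₂ (E-spans (x i))) zero) (∑-cong (suc ρ) (λ k → *-comm (w k i) (E k zero)))
        where
          w : Fin (suc ρ) → Vect F _
          w k i = proj₁ (E-spans (x i)) k

      strongBlocking⇒covers : ∀ {v} → ρ ≤ v → (B : Vect F v → Set ℓ) → StrongBlocking F K (suc ρ) B →
                              Covers F (suc ρ) B
      strongBlocking⇒covers ρ≤v B blocking x _ =
        let (w , w-rational , x∈w)    = rational-decomposition x
            (u , indep , u-rational , w⊆u) = independent-hull (s≤s ρ≤v) w w-rational
            (b , b∈B , _ , u⊆b)       = blocking u u-rational indep
        in b , b∈B , InSpanAnyC-trans {u = w} {b = b} x∈w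
                       (λ k → InSpan⇒InSpan-AnyC {C = K} {u = b} (InSpanK-trans {u = u} {b = b} (w⊆u k) u⊆b))

      basisPoint : ∀ {v} → Vect F v
      basisPoint i = E (clamp i) zero

      basisPoint-nonzero : ∀ {v} → ρ ≤ v → Nonzero F (basisPoint {v})
      basisPoint-nonzero ρ≤v x₀≈0 = LinIndep⇒nonzero {u = E} E-indep zero λ { zero →
        trans (reflexive (≡.cong (λ k → E k zero) (≡.sym (clamp-inject≤ zero (s≤s ρ≤v)))))
              (x₀≈0 (inject≤ zero (s≤s ρ≤v))) }

      -- If basisPoint = ∑ a_j s_j, then comparing E-coordinates in its first ρ + 1 entries shows
      -- that the restrictions of the s_j span the unit vectors of K^(ρ+1) over K.
      basisPoint-span-bound : ∀ {v p} → ρ ≤ v → (s : Fin p → Vect F v) → (∀ j → Rational F K (s j)) →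
                              InSpan F (AnyC F) s basisPoint → suc ρ ≤ p
      basisPoint-span-bound {v} {p} ρ≤v s s-rational (a , _ , x₀≈as) =
        LinIndep⇒≤ unitVector σ LinIndep-unitVector units∈σ
        where
          ι : Fin (suc ρ) → Fin (suc v)
          ι l = inject≤ l (s≤s ρ≤v)

          σ : Fin p → Vect F ρ
          σ j l = s j (ι l)

          d : Fin p → Fin (suc ρ) → A
          d j = proj₁ (E-spans (a j))

          K-d : ∀ j k → K (d j k)
          K-d j = proj₁ (proj₂ (E-spans (a j)))

          x₀≈σdE : ∀ l → basisPoint (ι l) ≈ ∑ (suc ρ) (λ k → ∑ p (λ j → σ j l * d j k) * E k zero)
          x₀≈σdE l = ∑-lincomb (λ j → σ j l) (λ j _ → a j) (λ _ → basisPoint (ι l)) d E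
                       (λ _ → trans (x₀≈as (ι l)) (∑-cong p (λ j → *-comm _ _)))
                       (λ j → proj₂ (proj₂ (E-spans (a j)))) zero

          x₀≈δE : ∀ l → basisPoint (ι l) ≈ ∑ (suc ρ) (λ k → δ k l * E k zero)
          x₀≈δE l = trans (reflexive (≡.cong (λ k → E k zero) (clamp-inject≤ l (s≤s ρ≤v))))
                          (sym (∑-δ (suc ρ) (λ k → E k zero) l))

          σd≈δ : ∀ l k → ∑ p (λ j → σ j l * d j k) ≈ δ k l
          σd≈δ l = LinIndep⇒coefficients-unique {u = E} E-indep _ _
                     (λ k → K-∑ p _ (λ j → K-* _ _ (s-rational j (ι l)) (K-d j k))) (λ k → K-δ k l)
                     (λ { zero → trans (sym (x₀≈σdE l)) (x₀≈δE l) })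

          units∈σ : ∀ k → InSpan F K σ (unitVector k)
          units∈σ k = (λ j → d j k) , (λ j → K-d j k) ,
                      λ l → trans (sym (σd≈δ l k)) (∑-cong p (λ j → *-comm _ _))

      pointSet⇒¬covers-fewer : ∀ {v} → ρ ≤ v → (B : Vect F v → Set ℓ) → IsPointSetOfSub F K B →
                               ∀ ϱ′ → ϱ′ < ρ → ¬ Covers F (suc ϱ′) B
      pointSet⇒¬covers-fewer ρ≤v B B-rational ϱ′ ϱ′<ρ covers with covers basisPoint (basisPoint-nonzero ρ≤v)
      ... | s , s∈B , x₀∈s =
        <⇒≱ (s≤s ϱ′<ρ) (basisPoint-span-bound ρ≤v s (λ j → proj₂ (B-rational _ (s∈B j))) x₀∈s)

theorem2 : ∀ {c ℓ : Level} (ρ q′ q v : ℕ) → 1 ≤ ρ → IsPrimePower q′ → q ≡ q′ ^ suc ρ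
    → suc ρ ≤ v
    → (F : CommutativeRing c ℓ) → IsField F → HasSize F q
    → (K : Carrier F → Set ℓ) → IsSubfield F K → SubHasSize F K q′
    → (B : Vect F v → Set ℓ) → IsPointSetOfSub F K B
    → StrongBlocking F K (suc ρ) B
    → Saturating F ρ B
theorem2 ρ q′ q v _ (p , m , p-prime , q′≡p^m+1) q≡q′^ρ+1 ρ<v F isField F-size K isSubfield K-size
         B B-rational blocking =
  strongBlocking⇒covers ρ≤v B blocking , pointSet⇒¬covers-fewer ρ≤v B B-rational
  where
    open SubfieldLinearAlgebra F isField (HasSize⇒decidable F F-size) K isSubfield
    open FiniteSubfield q′ K-size

    ρ≤v : ρ ≤ v
    ρ≤v = ≤-trans (n≤1+n ρ) ρ<v

    1<q′ : 1 < q′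
    1<q′ = ≡.subst (1 <_) (≡.sym q′≡p^m+1)
             (^-monoʳ-< p (nonTrivial⇒n>1 p {{prime⇒nonTrivial p-prime}}) {0} {suc m} z<s)

    basis : Σ (Fin (suc ρ) → Vect F 0) IsBasis
    basis = basis-of-size q F-size q≡q′^ρ+1 1<q′

    open Subgeometry (proj₁ basis) (proj₂ basis)
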